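{- Let $G=(A\cup B,E)$ be a marriage instance with critical set $C\subseteq A$, and let $G'$ be the instance constructed from $G$ as described in the context. In any stable matching $M'$ of $G'$, for every $m\in A$, at most one copy $m^i$ of $m$ is matched to a non-dummy woman (i.e. a woman of $B$).
   Context: A marriage instance is a bipartite graph $G=(A\cup B,E)$ ($A$ men, $B$ women) with strict preference lists; $\mathrm{Pref}(v)$ denotes the preference list of $v$; every vertex prefers being matched to being unmatched. A matching is stable if no edge $(a,b)$ outside it has both endpoints preferring each other to their current partners. Construction of $G'=(A'\cup B',E')$: let $\ell=|C|$. For $m\in C$, $A'$ contains copies $m^0,\dots,m^\ell$ and $B'$ contains dummy women $d_m^1,\dots,d_m^\ell$; for $m\in A\setminus C$, $A'$ contains only $m^0$ and there are no dummies. $B'$ also contains all of $B$. Preference lists: for $m\in A\setminus C$, $m^0$: $\mathrm{Pref}(m)$. For $m\in C$: $m^0$: $\mathrm{Pref}(m)$ followed by $d_m^1$; $m^i$ ($1\le i\le\ell-1$): $d_m^i$, then $\mathrm{Pref}(m)$, then $d_m^{i+1}$; $m^\ell$: $d_m^\ell$ followed by $\mathrm{Pref}(m)$. For $w\in B$: the level-$\ell$ copies of the men in $\mathrm{Pref}(w)$ (those that exist) in the order of $\mathrm{Pref}(w)$, then the level-$(\ell-1)$ copies, and so on down to level $0$. For $d_m^i$: $m^{i-1}$ then $m^i$. -}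

module Defs where

open import Data.Nat using (ℕ; zero; suc; _<?_)
open import Data.Bool using (Bool; true; false; if_then_else_)
open import Data.Fin using (Fin; zero; suc; toℕ; fromℕ<; inject₁)
open import Data.Fin.Subset using (Subset; _∈_; ∣_∣)
open import Data.Fin.Subset.Properties using (_∈?_)
open import Data.List using (List; []; _∷_; _++_; [_]; concatMap; mapMaybe; downFrom)
open import Data.List.Relation.Unary.Unique.Propositional using (Unique)
import Data.List.Membership.Propositional as Mem
open import Data.Maybe using (Maybe; just; nothing)
open import Data.Product using (Σ; ∃; ∃-syntax; _×_; _,_)
open import Data.Sum using (_⊎_; inj₁; inj₂)
open import Relation.Nullary using (¬_; yes; no)
open import Relation.Binary.PropositionalEquality using (_≡_; _≢_)
open import Function.Bundles using (_⇔_)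

record Instance : Set₁ where
  field
    Man   : Set
    Woman : Set
    prefM : Man → List Woman
    prefW : Woman → List Man

-- x occurs strictly before y in the list (x is preferred to y)
Before : {X : Set} → List X → X → X → Set
Before {X} l x y = Σ (List X) λ xs → Σ (List X) λ ys → l ≡ xs ++ (x ∷ ys) × y Mem.∈ ys

module _ (I : Instance) where
  open Instance I

  IsMatching : (Man → Maybe Woman) → Set
  IsMatching μ =
    (∀ a b → μ a ≡ just b → (b Mem.∈ prefM a) × (a Mem.∈ prefW b)) ×
    (∀ a a' b → μ a ≡ just b → μ a' ≡ just b → a ≡ a')

  ManPrefers : (Man → Maybe Woman) → Man → Woman → Set
  ManPrefers μ a b = (μ a ≡ nothing) ⊎ (∃[ b' ] (μ a ≡ just b' × Before (prefM a) b b'))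

  WomanPrefers : (Man → Maybe Woman) → Woman → Man → Set
  WomanPrefers μ b a = (∀ a' → μ a' ≢ just b) ⊎ (∃[ a' ] (μ a' ≡ just b × Before (prefW b) a a'))

  BlockingPair : (Man → Maybe Woman) → Man → Woman → Set
  BlockingPair μ a b =
    (b Mem.∈ prefM a) × (a Mem.∈ prefW b) × (μ a ≢ just b) ×
    ManPrefers μ a b × WomanPrefers μ b a

  IsStable : (Man → Maybe Woman) → Set
  IsStable μ = IsMatching μ × (∀ a b → ¬ BlockingPair μ a b)

record Marriage (nA nB : ℕ) : Set where
  field
    prefA : Fin nA → List (Fin nB)
    prefB : Fin nB → List (Fin nA)
    uniqueA : ∀ a → Unique (prefA a)
    uniqueB : ∀ b → Unique (prefB b)
    edges : ∀ a b → (b Mem.∈ prefA a) ⇔ (a Mem.∈ prefB b)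

toInstance : ∀ {nA nB} → Marriage nA nB → Instance
toInstance {nA} {nB} G = record
  { Man = Fin nA ; Woman = Fin nB ; prefM = Marriage.prefA G ; prefW = Marriage.prefB G }

module Construction {nA nB : ℕ} (G : Marriage nA nB) (C : Subset nA) where
  open Marriage G

  ℓ : ℕ
  ℓ = ∣ C ∣

  -- number of dummies (= highest copy level) for man m: ℓ if m ∈ C, else 0
  lev : Fin nA → ℕ
  lev m with m ∈? C
  ... | yes _ = ℓ
  ... | no  _ = 0

  -- copy m^i, i ∈ {0..lev m}
  Man' : Set
  Man' = Σ (Fin nA) λ m → Fin (suc (lev m))

  -- dummy (m , j) stands for d_m^{j+1}, j ∈ {0..lev m - 1}
  Dummy : Set
  Dummy = Σ (Fin nA) λ m → Fin (lev m)

  Woman' : Set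
  Woman' = Fin nB ⊎ Dummy

  -- d_m^i for i ≥ 1 (listed first by m^i)
  prefixD : (m : Fin nA) → Fin (suc (lev m)) → List Woman'
  prefixD m zero    = []
  prefixD m (suc j) = [ inj₂ (m , j) ]

  -- d_m^{i+1} if i < lev m (listed last by m^i)
  suffixD : (m : Fin nA) → Fin (suc (lev m)) → List Woman'
  suffixD m i with toℕ i <? lev m
  ... | yes p = [ inj₂ (m , fromℕ< p) ]
  ... | no  _ = []

  prefM' : Man' → List Woman'
  prefM' (m , i) = prefixD m i ++ (Data.List.map inj₁ (prefA m) ++ suffixD m i)
    where import Data.List

  copyAt : ℕ → Fin nA → Maybe Man'
  copyAt L m with L <? suc (lev m)
  ... | yes p = just (m , fromℕ< p)
  ... | no  _ = nothing

  prefB' : Fin nB → List Man'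
  prefB' b = concatMap (λ L → mapMaybe (λ m → copyAt L m) (prefB b)) (downFrom (suc ℓ))

  prefW' : Woman' → List Man'
  prefW' (inj₁ b)       = prefB' b
  prefW' (inj₂ (m , j)) = (m , inject₁ j) ∷ (m , suc j) ∷ []

  G' : Instance
  G' = record { Man = Man' ; Woman = Woman' ; prefM = prefM' ; prefW = prefW' }

-- If m^i is matched to a woman of B then m^i does not hold d_m^{i+1}.  Since
-- d_m^{i+1} is the first choice of m^{i+1} and only m^i and m^{i+1} accept her,
-- stability forces m^{i+1} to hold her, so m^{i+1} does not hold d_m^{i+2}, and so
-- on: every copy above m^i holds its lower dummy, hence none of them is matched
-- to a woman of B.
module Submission where

open import Defs
open import Data.Nat using (suc)
open import Data.Fin using (Fin)
open import Data.Fin.Subset using (Subset)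
open import Data.Maybe using (Maybe; just)
open import Data.Product using (_,_)
open import Data.Sum using (inj₁)
open import Relation.Binary.PropositionalEquality using (_≡_)

import Data.Nat.Properties as ℕ
open import Data.Empty using (⊥-elim)
open import Data.Fin using (suc; toℕ; inject₁; _≤_; _<_)
open import Data.Fin.Induction using (<-weakInduction-startingFrom)
open import Data.Fin.Properties using (toℕ-inject₁; <-cmp)
open import Data.List using ([]; _∷_)
open import Data.List.Membership.Propositional using (_∈_)
open import Data.List.Relation.Unary.Any using (here; there)
open import Data.Maybe using (nothing)
open import Data.Product using (∃-syntax; _×_; proj₁; proj₂)
open import Data.Sum using (inj₂)
open import Relation.Binary using (tri<; tri≈; tri>)
open import Relation.Binary.PropositionalEquality using (refl; sym; trans; cong; subst; _≢_)
open import Relation.Nullary using (¬_)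

module _ (I : Instance) where
  open Instance I

  first-choice-preferred : ∀ {μ} → IsMatching I μ → ∀ {a b rest} →
    prefM a ≡ b ∷ rest → (∀ a' → μ a' ≢ just b) → ManPrefers I μ a b
  first-choice-preferred {μ} matching {a} first unmatched with μ a in eq
  ... | nothing = inj₁ refl
  ... | just b' with subst (b' ∈_) first (proj₁ (proj₁ matching a b' eq))
  ...   | here refl       = ⊥-elim (unmatched a eq)
  ...   | there b'∈rest = inj₂ (b' , refl , [] , _ , first , b'∈rest)

  first-choice-matched : ∀ {μ} → IsStable I μ → ∀ {a b rest} →
    prefM a ≡ b ∷ rest → a ∈ prefW b → ¬ (∀ a' → μ a' ≢ just b)
  first-choice-matched (matching , no-blocking) {a} {b} first a∈b unmatched =
    no-blocking a b ( subst (b ∈_) (sym first) (here refl) , a∈b , unmatched a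
                    , first-choice-preferred matching first unmatched , inj₁ unmatched )

module _ {nA nB} {G : Marriage nA nB} {C : Subset nA} where
  open Construction G C

  module _ {μ : Man' → Maybe Woman'} (stable : IsStable G' μ) (m : Fin nA) where

    dummy-held : (j : Fin (lev m)) → μ (m , inject₁ j) ≢ just (inj₂ (m , j)) →
      ¬ μ (m , suc j) ≢ just (inj₂ (m , j))
    dummy-held j ¬lower ¬upper =
      first-choice-matched G' stable refl (there (here refl)) unmatched
      where
      unmatched : ∀ a → μ a ≢ just (inj₂ (m , j))
      unmatched a eq with proj₂ (proj₁ (proj₁ stable) a _ eq)
      ... | here refl         = ¬lower eq
      ... | there (here refl) = ¬upper eq
      ... | there (there ())

    HoldsUpperDummy : Fin (suc (lev m)) → Set
    HoldsUpperDummy k = ∃[ j ] (inject₁ j ≡ k × μ (m , k) ≡ just (inj₂ (m , j)))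

    upper-dummy-free-suc : (j : Fin (lev m)) →
      ¬ HoldsUpperDummy (inject₁ j) → ¬ HoldsUpperDummy (suc j)
    upper-dummy-free-suc j free (j' , inject₁j'≡sucj , holds) =
      dummy-held j (λ holds' → free (j , refl , holds')) holds-other
      where
      holds-other : μ (m , suc j) ≢ just (inj₂ (m , j))
      holds-other holds-j with trans (sym holds) holds-j
      ... | refl = ℕ.1+n≢n (trans (sym (cong toℕ inject₁j'≡sucj)) (toℕ-inject₁ j))

    B-partner-frees-above : ∀ {i b} → μ (m , i) ≡ just (inj₁ b) →
      ∀ {k} → i ≤ k → ¬ HoldsUpperDummy k
    B-partner-frees-above {i} partner =
      <-weakInduction-startingFrom (λ k → ¬ HoldsUpperDummy k) free-at-i upper-dummy-free-suc
      where
      free-at-i : ¬ HoldsUpperDummy i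
      free-at-i (_ , _ , holds) with trans (sym partner) holds
      ... | ()

    B-partners-not-increasing : ∀ {i j b b'} →
      μ (m , i) ≡ just (inj₁ b) → μ (m , j) ≡ just (inj₁ b') → ¬ i < j
    B-partners-not-increasing {i} {suc j} partner partner' i<sucj =
      dummy-held j (λ holds → B-partner-frees-above partner i≤j (j , refl , holds))
                   (λ holds → B≢dummy (trans (sym partner') holds))
      where
      i≤j : i ≤ inject₁ j
      i≤j = ℕ.≤-trans (ℕ.≤-pred i<sucj) (ℕ.≤-reflexive (sym (toℕ-inject₁ j)))
      B≢dummy : ∀ {b'} → just (inj₁ b') ≢ just (inj₂ (m , j))
      B≢dummy ()

mainTheorem5 : ∀ {nA nB} (G : Marriage nA nB) (C : Subset nA) →
    let open Construction G C in
    (μ : Man' → Maybe Woman') → IsStable G' μ →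
    ∀ (m : Fin nA) (i j : Fin (suc (lev m))) (b b' : Fin nB) →
    μ (m , i) ≡ just (inj₁ b) → μ (m , j) ≡ just (inj₁ b') → i ≡ j
mainTheorem5 G C μ stable m i j b b' partner partner' with <-cmp i j
... | tri< i<j _ _ = ⊥-elim (B-partners-not-increasing stable m partner partner' i<j)
... | tri≈ _ i≡j _ = i≡j
... | tri> _ _ j<i = ⊥-elim (B-partners-not-increasing stable m partner' partner j<i)
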